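{- Let $n\ge3$, $1\le i\le n-2$, $a_i,a_{i+1}$ positive integers, and let $A_i\subset Q_i$, $A_{i+1}\subset Q_{i+1}$ be $\preceq$-antichains such that $a_i\chi_{A_i}+a_{i+1}\chi_{A_{i+1}}$ is a vertex of $P_{a_i\omega_i+a_{i+1}\omega_{i+1}}$. Then for any two $\preceq$-comparable elements $(k_1,l_1)\in A_i$ and $(k_2,l_2)\in A_{i+1}$ we have $(k_1,l_1)\preceq(k_2,l_2)$.
   Context: $U=\mathbb R^{\binom n2}$ with coordinates $x_{k,l}$, $1\le k<l\le n$. A Dyck path is a sequence $d=((i_1,j_1),\ldots,(i_N,j_N))$ of pairs with $1\le i_k<j_k\le n$, $j_1-i_1=j_N-i_N=1$, and each $(i_{k+1},j_{k+1})$ equal to $(i_k+1,j_k)$ or $(i_k,j_k+1)$. For $\mu=\sum b_m\omega_m$ ($b_m\ge0$ integers) let $M(\mu,d)=b_{i_1}+b_{i_1+1}+\ldots+b_{i_N}$ and $P_\mu=\{x\in U:x\ge0,\ \sum_{(k,l)\in d}x_{k,l}\le M(\mu,d)\ \forall d\}$. Pairs are ordered by $(k_1,l_1)\preceq(k_2,l_2)$ iff $k_1\le k_2$, $l_1\le l_2$. $Q_m=\{(k,l):1\le k\le m,\ m+1\le l\le n\}$; $\chi_A$ is the indicator function of $A$. -}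

module Defs where

open import Data.Nat as ℕ using (ℕ; zero; suc; _∸_)
open import Data.Bool using (Bool; true; false; if_then_else_)
open import Data.Product using (_×_; _,_; proj₁; proj₂)
open import Data.List using (List; []; _∷_; map; upTo; foldr)
open import Data.Nat.ListAction using (sum)
open import Relation.Nullary using (yes; no)
open import Data.List.Relation.Unary.All using (All)
open import Data.Unit using (⊤)
open import Data.Integer using (+_)
open import Data.Rational as ℚ using (ℚ; 0ℚ; 1ℚ; ½)
open import Relation.Binary.PropositionalEquality using (_≡_)

-- A pair (k , l) of natural numbers; coordinates of U are indexed by
-- the valid pairs 1 ≤ k < l ≤ n.
Pair : Set
Pair = ℕ × ℕ

ValidPair : ℕ → Pair → Set
ValidPair n (k , l) = (1 ℕ.≤ k) × (k ℕ.< l) × (l ℕ.≤ n)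

_⪯_ : Pair → Pair → Set
(k₁ , l₁) ⪯ (k₂ , l₂) = (k₁ ℕ.≤ k₂) × (l₁ ℕ.≤ l₂)

InQ : ℕ → ℕ → Pair → Set
InQ n m (k , l) = (1 ℕ.≤ k) × (k ℕ.≤ m) × (suc m ℕ.≤ l) × (l ℕ.≤ n)

-- A point of U = ℝ^{n choose 2} (rational coordinates):
-- only the values at valid pairs matter.
Point : Set
Point = Pair → ℚ

data Step : Pair → Pair → Set where
  down  : ∀ {i j} → Step (i , j) (suc i , j)
  right : ∀ {i j} → Step (i , j) (i , suc j)

StepsOK : Pair → List Pair → Set
StepsOK p []       = ⊤
StepsOK p (q ∷ qs) = Step p q × StepsOK q qs

lastPair : Pair → List Pair → Pair
lastPair p []       = p
lastPair p (q ∷ qs) = lastPair q qs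

Diagonal : Pair → Set
Diagonal (i , j) = j ≡ suc i

record DyckPath (n : ℕ) : Set where
  constructor dyck
  field
    start : Pair
    rest  : List Pair
    valid : All (ValidPair n) (start ∷ rest)
    steps : StepsOK start rest
    first-diag : Diagonal start
    last-diag  : Diagonal (lastPair start rest)

open DyckPath public

pairs : ∀ {n} → DyckPath n → List Pair
pairs d = start d ∷ rest d

sumAlong : ∀ {n} → Point → DyckPath n → ℚ
sumAlong x d = foldr ℚ._+_ 0ℚ (map x (pairs d))

rangeSum : (ℕ → ℕ) → ℕ → ℕ → ℕ
rangeSum b lo hi = sum (map (λ t → b (lo ℕ.+ t)) (upTo (suc hi ∸ lo)))

-- M(μ,d) for μ = Σ b_m ω_m
M : ∀ {n} → (ℕ → ℕ) → DyckPath n → ℕ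
M b d = rangeSum b (proj₁ (start d)) (proj₁ (lastPair (start d) (rest d)))

ℕtoℚ : ℕ → ℚ
ℕtoℚ m = (+ m) ℚ./ 1

InP : ℕ → (ℕ → ℕ) → Point → Set
InP n b x =
  (∀ p → ValidPair n p → 0ℚ ℚ.≤ x p) ×
  (∀ (d : DyckPath n) → sumAlong x d ℚ.≤ ℕtoℚ (M b d))

IsVertex : ℕ → (ℕ → ℕ) → Point → Set
IsVertex n b x =
  InP n b x ×
  (∀ y z → InP n b y → InP n b z →
     (∀ p → ValidPair n p → x p ≡ ½ ℚ.* (y p ℚ.+ z p)) →
     ∀ p → ValidPair n p → y p ≡ z p)

Subset : Set
Subset = Pair → Bool

_∈_ : Pair → Subset → Set
p ∈ A = A p ≡ true

_⊆Q[_,_] : Subset → ℕ → ℕ → Set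
A ⊆Q[ n , m ] = ∀ p → p ∈ A → InQ n m p

Antichain : Subset → Set
Antichain A = ∀ p q → p ∈ A → q ∈ A → p ⪯ q → p ≡ q

χ : Subset → Point
χ A p = if A p then 1ℚ else 0ℚ

-- μ = a ω_i + a' ω_{i+1} as its coefficient function b
twoWeight : ℕ → ℕ → ℕ → ℕ → ℕ
twoWeight i a a' m with m ℕ.≟ i | m ℕ.≟ suc i
... | yes _ | _ = a
... | no _ | yes _ = a'
... | no _ | no _ = 0

combo : ℕ → Subset → ℕ → Subset → Point
combo a A a' A' p = ℕtoℚ a ℚ.* χ A p ℚ.+ ℕtoℚ a' ℚ.* χ A' p

-- Suppose q ⪯ p with p ∈ A and q ∈ A'. Let A↑ be the elements of A lying above some
-- element of A', and A'↓ the elements of A' lying below some element of A. Moving one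
-- unit of weight from A'↓ to A↑, or from A↑ to A'↓, gives integral points y and z with
-- x = (y + z) / 2, and both stay in P_μ: a Dyck path is a chain, so it meets each
-- antichain at most once; if it meets A↑ but not A'↓ it meets no element of A' at all, so
-- its x-sum is at most a_i, while it passes through rows i and i + 1, so M ≥ a_i + a_{i+1}.
-- Since x is a vertex, y = z, whence A'↓ ⊆ A↑ ⊆ A. So q ∈ A, and q = p as A is an antichain.
module Submission where

open import Defs
open import Data.Bool using (true; false; if_then_else_)
import Data.Bool.Properties as Bool
open import Data.Empty using (⊥-elim)
open import Data.Fin using (Fin; toℕ; fromℕ<)
open import Data.Fin.Properties using (any?; toℕ≤pred[n]; toℕ-fromℕ<)
import Data.Integer as ℤ
import Data.Integer.Properties as ℤP
open import Data.List using (List; []; _∷_; map; foldr; applyUpTo)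
open import Data.List.Membership.Propositional renaming (_∈_ to _∈L_)
open import Data.List.Properties using (map-applyUpTo; map-cong)
import Data.List.Relation.Unary.All as All
open import Data.List.Relation.Unary.AllPairs using (AllPairs; _∷_)
open import Data.List.Relation.Unary.Any using (here; there)
open import Data.List.Relation.Unary.Linked using (Linked; [-]; _∷_)
open import Data.List.Relation.Unary.Linked.Properties using (Linked⇒AllPairs)
open import Data.Nat as ℕ using (ℕ; zero; suc; _+_; _*_; _∸_; _≤_; _<_; z≤n; s≤s)
import Data.Nat.Coprimality as Coprimality
open import Data.Nat.ListAction using (sum)
import Data.Nat.Properties as ℕP
open import Algebra.Properties.CommutativeSemigroup ℕP.+-commutativeSemigroup using (interchange)
open import Data.Product using (_×_; _,_; proj₁; proj₂; ∃)
open import Data.Rational as ℚ using (0ℚ; ½; mkℚ)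
import Data.Rational.Properties as ℚP
import Data.Rational.Unnormalised as ℚᵘ
import Data.Rational.Unnormalised.Properties as ℚᵘP
open import Data.Sum using (_⊎_; inj₁; inj₂)
open import Function using (id; _∘_; case_of_)
open import Relation.Binary.Definitions using (Decidable)
open import Relation.Binary.PropositionalEquality
open import Relation.Nullary using (¬_; Dec; yes; no; does)
open import Relation.Nullary.Decidable using (_×-dec_; map′)

ℕtoℚ≡mkℚ : ∀ m → ℕtoℚ m ≡ mkℚ (ℤ.+ m) 0 (Coprimality.sym (Coprimality.1-coprimeTo m))
ℕtoℚ≡mkℚ m = ℚP.normalize-coprime (Coprimality.sym (Coprimality.1-coprimeTo m))

ℕtoℚ-mono-≤ : ∀ {m n} → m ≤ n → ℕtoℚ m ℚ.≤ ℕtoℚ n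
ℕtoℚ-mono-≤ {m} {n} m≤n rewrite ℕtoℚ≡mkℚ m | ℕtoℚ≡mkℚ n =
  ℚ.*≤* (subst₂ ℤ._≤_ (sym (ℤP.*-identityʳ (ℤ.+ m))) (sym (ℤP.*-identityʳ (ℤ.+ n))) (ℤ.+≤+ m≤n))

ℕtoℚ-cancel-≤ : ∀ {m n} → ℕtoℚ m ℚ.≤ ℕtoℚ n → m ≤ n
ℕtoℚ-cancel-≤ {m} {n} le rewrite ℕtoℚ≡mkℚ m | ℕtoℚ≡mkℚ n =
  ℤP.drop‿+≤+ (subst₂ ℤ._≤_ (ℤP.*-identityʳ (ℤ.+ m)) (ℤP.*-identityʳ (ℤ.+ n)) (ℚP.drop-*≤* le))

ℕtoℚ-injective : ∀ {m n} → ℕtoℚ m ≡ ℕtoℚ n → m ≡ n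
ℕtoℚ-injective e = ℕP.≤-antisym (ℕtoℚ-cancel-≤ (ℚP.≤-reflexive e)) (ℕtoℚ-cancel-≤ (ℚP.≤-reflexive (sym e)))

ℕtoℚ-homo-+ : ∀ m n → ℕtoℚ (m + n) ≡ ℕtoℚ m ℚ.+ ℕtoℚ n
ℕtoℚ-homo-+ m n = ℚP.toℚᵘ-injective
  (ℚᵘP.≃-trans toℚᵘ-homo (ℚᵘP.≃-sym (ℚP.toℚᵘ-homo-+ (ℕtoℚ m) (ℕtoℚ n))))
  where
  toℚᵘ-homo : ℚ.toℚᵘ (ℕtoℚ (m + n)) ℚᵘ.≃ ℚ.toℚᵘ (ℕtoℚ m) ℚᵘ.+ ℚ.toℚᵘ (ℕtoℚ n)
  toℚᵘ-homo rewrite ℕtoℚ≡mkℚ m | ℕtoℚ≡mkℚ n | ℕtoℚ≡mkℚ (m + n) =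
    ℚᵘ.*≡* (cong (ℤ._* ℤ.+ 1) (trans (ℤP.pos-+ m n)
      (cong₂ ℤ._+_ (sym (ℤP.*-identityʳ (ℤ.+ m))) (sym (ℤP.*-identityʳ (ℤ.+ n))))))

½*[r+r]≡r : ∀ r → ½ ℚ.* (r ℚ.+ r) ≡ r
½*[r+r]≡r r = trans (ℚP.*-distribˡ-+ ½ r r) (trans (sym (ℚP.*-distribʳ-+ r ½ ½)) (ℚP.*-identityˡ r))

Comparable : Pair → Pair → Set
Comparable u v = u ⪯ v ⊎ v ⪯ u

⪯-refl : ∀ u → u ⪯ u
⪯-refl (k , l) = ℕP.≤-refl , ℕP.≤-refl

⪯-trans : ∀ {u v w} → u ⪯ v → v ⪯ w → u ⪯ w
⪯-trans (k≤ , l≤) (k≤′ , l≤′) = ℕP.≤-trans k≤ k≤′ , ℕP.≤-trans l≤ l≤′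

_⪯?_ : Decidable _⪯_
(k , l) ⪯? (k′ , l′) = (k ℕ.≤? k′) ×-dec (l ℕ.≤? l′)

-- The k + l component makes ≺ strict, so an antichain meets a ≺-chain at most once.
_≺_ : Pair → Pair → Set
u ≺ v = u ⪯ v × proj₁ u + proj₂ u < proj₁ v + proj₂ v

≺-trans : ∀ {u v w} → u ≺ v → v ≺ w → u ≺ w
≺-trans (u⪯v , u<v) (v⪯w , v<w) = ⪯-trans u⪯v v⪯w , ℕP.<-trans u<v v<w

Step⇒≺ : ∀ {u v} → Step u v → u ≺ v
Step⇒≺ (down {i} {j}) = (ℕP.n≤1+n i , ℕP.≤-refl) , ℕP.≤-refl
Step⇒≺ (right {i} {j}) = (ℕP.≤-refl , ℕP.n≤1+n j) , ℕP.≤-reflexive (sym (ℕP.+-suc i j))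

StepsOK⇒Linked : ∀ u vs → StepsOK u vs → Linked _≺_ (u ∷ vs)
StepsOK⇒Linked u [] _ = [-]
StepsOK⇒Linked u (v ∷ vs) (step , steps) = Step⇒≺ step ∷ StepsOK⇒Linked v vs steps

pairs-≺-chain : ∀ {n} (d : DyckPath n) → AllPairs _≺_ (pairs d)
pairs-≺-chain d = Linked⇒AllPairs ≺-trans (StepsOK⇒Linked (start d) (rest d) (steps d))

chain-comparable : ∀ {L} → AllPairs _≺_ L → ∀ {u v} → u ∈L L → v ∈L L → Comparable u v
chain-comparable {w ∷ _} _ (here refl) (here refl) = inj₁ (⪯-refl w)
chain-comparable (w≺ ∷ _) (here refl) (there v∈) = inj₁ (proj₁ (All.lookup w≺ v∈))
chain-comparable (w≺ ∷ _) (there u∈) (here refl) = inj₂ (proj₁ (All.lookup w≺ u∈))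
chain-comparable (_ ∷ chain) (there u∈) (there v∈) = chain-comparable chain u∈ v∈

start-⪯ : ∀ {n} (d : DyckPath n) {u} → u ∈L pairs d → start d ⪯ u
start-⪯ d (here refl) = ⪯-refl (start d)
start-⪯ d (there u∈) with pairs-≺-chain d
... | start≺ ∷ _ = proj₁ (All.lookup start≺ u∈)

⪯-lastPair : ∀ u vs → StepsOK u vs → ∀ {w} → w ∈L (u ∷ vs) → w ⪯ lastPair u vs
⪯-lastPair u [] _ (here refl) = ⪯-refl u
⪯-lastPair u (v ∷ vs) (step , steps) (here refl) =
  ⪯-trans (proj₁ (Step⇒≺ step)) (⪯-lastPair v vs steps (here refl))
⪯-lastPair u (v ∷ vs) (_ , steps) (there w∈) = ⪯-lastPair v vs steps w∈

adjacent≤sum-applyUpTo : ∀ (f : ℕ → ℕ) j {m} → suc j < m → f j + f (suc j) ≤ sum (applyUpTo f m)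
adjacent≤sum-applyUpTo f zero (s≤s (s≤s _)) = ℕP.+-monoʳ-≤ (f 0) (ℕP.m≤m+n (f 1) _)
adjacent≤sum-applyUpTo f (suc j) {suc m} (s≤s j+1<m) =
  ℕP.≤-trans (adjacent≤sum-applyUpTo (f ∘ suc) j j+1<m) (ℕP.m≤n+m _ (f 0))

adjacent≤rangeSum : ∀ b {s t i} → s ≤ i → i < t → b i + b (suc i) ≤ rangeSum b s t
adjacent≤rangeSum b {s} {t} s≤i i<t with ℕP.m≤n⇒∃[o]m+o≡n s≤i
... | j , refl rewrite map-applyUpTo id (λ k → b (s + k)) (suc t ∸ s) | sym (ℕP.+-suc s j) =
  adjacent≤sum-applyUpTo (λ k → b (s + k)) j
    (ℕP.m+n≤o⇒m≤o∸n (suc (suc j)) (s≤s (subst (_≤ t) (ℕP.+-comm s (suc j)) i<t)))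

Straddles : ℕ → Pair → Set
Straddles i (k , l) = k ≤ i × suc (suc i) ≤ l

straddles⇒≤M : ∀ {n} (b : ℕ → ℕ) (d : DyckPath n) {i u} → u ∈L pairs d → Straddles i u →
               b i + b (suc i) ≤ M b d
straddles⇒≤M b d {i} u∈ (k≤i , i+2≤l) =
  adjacent≤rangeSum b (ℕP.≤-trans (proj₁ (start-⪯ d u∈)) k≤i) (ℕP.≤-pred i+2≤last)
  where
  i+2≤last : suc (suc i) ≤ suc (proj₁ (lastPair (start d) (rest d)))
  i+2≤last = ℕP.≤-trans i+2≤l (ℕP.≤-trans (proj₂ (⪯-lastPair (start d) (rest d) (steps d) u∈))
                                          (ℕP.≤-reflexive (last-diag d)))

𝟙 : Subset → Pair → ℕ
𝟙 B u = if B u then 1 else 0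

𝟙-shift-cancel : ∀ m B C {u} → u ∈ C → m + 𝟙 B u ∸ 𝟙 C u ≡ m + 𝟙 C u ∸ 𝟙 B u → u ∈ B
𝟙-shift-cancel m B C {u} u∈C shift≡ with B u | C u
... | true | _ = refl
... | false | true =
  ⊥-elim (ℕP.<-irrefl shift≡ (ℕP.≤-<-trans (ℕP.m∸n≤m (m + 0) 1) (ℕP.+-monoʳ-< m (s≤s z≤n))))
... | false | false = case u∈C of λ ()

m∸𝟙+𝟙≡m : ∀ m B {u} → (u ∈ B → 1 ≤ m) → m ∸ 𝟙 B u + 𝟙 B u ≡ m
m∸𝟙+𝟙≡m m B {u} u∈B⇒1≤m with B u
... | true = ℕP.m∸n+n≡m (u∈B⇒1≤m refl)
... | false = ℕP.+-identityʳ m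

Σ⟨_⟩ : (Pair → ℕ) → List Pair → ℕ
Σ⟨ f ⟩ L = sum (map f L)

Σ-+ : ∀ f g L → Σ⟨ (λ u → f u + g u) ⟩ L ≡ Σ⟨ f ⟩ L + Σ⟨ g ⟩ L
Σ-+ f g [] = refl
Σ-+ f g (u ∷ L) = trans (cong (f u + g u +_) (Σ-+ f g L)) (interchange (f u) (g u) (Σ⟨ f ⟩ L) (Σ⟨ g ⟩ L))

Σ-* : ∀ c f L → Σ⟨ (λ u → c * f u) ⟩ L ≡ c * Σ⟨ f ⟩ L
Σ-* c f [] = sym (ℕP.*-zeroʳ c)
Σ-* c f (u ∷ L) = trans (cong (c * f u +_) (Σ-* c f L)) (sym (ℕP.*-distribˡ-+ c (f u) (Σ⟨ f ⟩ L)))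

Σ-+-cong : ∀ f g h k → (∀ u → f u + g u ≡ h u + k u) → ∀ L →
           Σ⟨ f ⟩ L + Σ⟨ g ⟩ L ≡ Σ⟨ h ⟩ L + Σ⟨ k ⟩ L
Σ-+-cong f g h k f+g≗h+k L =
  trans (sym (Σ-+ f g L)) (trans (cong sum (map-cong f+g≗h+k L)) (Σ-+ h k L))

count : Subset → List Pair → ℕ
count B = Σ⟨ 𝟙 B ⟩

count-none : ∀ {B} L → (∀ {u} → u ∈L L → ¬ u ∈ B) → count B L ≡ 0
count-none [] _ = refl
count-none {B} (u ∷ L) u∉B with B u in u∈B
... | true = ⊥-elim (u∉B (here refl) u∈B)
... | false = count-none L (u∉B ∘ there)

count-mono : ∀ {B C} L → (∀ {u} → u ∈L L → u ∈ B → u ∈ C) → count B L ≤ count C L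
count-mono [] _ = z≤n
count-mono {B} {C} (u ∷ L) B⊆C with B u in u∈B
... | true rewrite B⊆C (here refl) u∈B = s≤s (count-mono L (B⊆C ∘ there))
... | false = ℕP.m≤n⇒m≤o+n (𝟙 C u) (count-mono L (B⊆C ∘ there))

count-pos : ∀ {B} L → 1 ≤ count B L → ∃ λ u → u ∈L L × u ∈ B
count-pos {B} (u ∷ L) pos with B u in u∈B
... | true = u , here refl , u∈B
... | false with count-pos L pos
...   | v , v∈L , v∈B = v , there v∈L , v∈B

count-antichain : ∀ {B L} → Antichain B → AllPairs _≺_ L → count B L ≤ 1
count-antichain {L = []} _ _ = z≤n
count-antichain {B} {u ∷ L} B-antichain (u≺ ∷ chain) with B u in u∈B
... | false = count-antichain B-antichain chain
... | true = ℕP.≤-reflexive (cong suc (count-none L λ v∈L v∈B →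
    let u⪯v , u<v = All.lookup u≺ v∈L
    in ℕP.<-irrefl (cong (λ w → proj₁ w + proj₂ w) (B-antichain u _ u∈B v∈B u⪯v)) u<v))

-- On one Dyck path: cA, cA' count the entries in A, A'; c, c' those gaining and losing a unit.
shift-bound : ∀ {a a' m cA cA' c c'} → 1 ≤ a' → cA ≤ 1 → c ≤ cA →
  (1 ≤ c → a + a' ≤ m) → (1 ≤ c → cA' ≤ c') →
  a * cA + a' * cA' ≤ m → a * cA + a' * cA' + c ≤ m + c'
shift-bound {m = m} {c = zero} {c'} _ _ _ _ _ X≤m =
  ℕP.≤-trans (ℕP.≤-reflexive (ℕP.+-identityʳ _)) (ℕP.≤-trans X≤m (ℕP.m≤m+n m c'))
shift-bound {c = suc _} {suc _} _ (s≤s z≤n) (s≤s z≤n) _ _ X≤m = ℕP.+-mono-≤ X≤m (s≤s z≤n)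
shift-bound {a} {a'} {m} {c = suc _} {zero} 1≤a' (s≤s z≤n) (s≤s z≤n) a+a'≤m cA'≤0 _
  with cA'≤0 (s≤s z≤n)
... | z≤n = begin
  a * 1 + a' * 0 + 1 ≡⟨ cong (_+ 1) (trans (cong₂ _+_ (ℕP.*-identityʳ a) (ℕP.*-zeroʳ a')) (ℕP.+-identityʳ a)) ⟩
  a + 1              ≤⟨ ℕP.+-monoʳ-≤ a 1≤a' ⟩
  a + a'             ≤⟨ a+a'≤m (s≤s z≤n) ⟩
  m                  ≡⟨ ℕP.+-identityʳ m ⟨
  m + 0              ∎
  where open ℕP.≤-Reasoning

chain-shift-bound : ∀ {B B' C C' : Subset} {L b b' m} → AllPairs _≺_ L → Antichain B → 1 ≤ b' →
  (∀ {u} → u ∈ C → u ∈ B) →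
  (∀ {u v} → u ∈ C → v ∈ B' → Comparable u v → v ∈ C') →
  (∀ {u} → u ∈L L → u ∈ C → b + b' ≤ m) →
  b * count B L + b' * count B' L ≤ m →
  b * count B L + b' * count B' L + count C L ≤ m + count C' L
chain-shift-bound {B} {B'} {C} {C'} {L} chain B-antichain 1≤b' C⊆B C-closed C⇒b+b'≤m =
  shift-bound 1≤b' (count-antichain B-antichain chain) (count-mono L λ _ → C⊆B)
    (λ pos → let _ , u∈L , u∈C = count-pos L pos in C⇒b+b'≤m u∈L u∈C)
    (λ pos → let _ , u∈L , u∈C = count-pos L pos in
      count-mono L λ v∈L v∈B' → C-closed u∈C v∈B' (chain-comparable chain u∈L v∈L))

Bounded : ℕ → Pair → Set
Bounded n (k , l) = k ≤ n × l ≤ n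

∃-bounded? : ∀ n {P : Pair → Set} → (∀ u → Dec (P u)) → Dec (∃ λ u → Bounded n u × P u)
∃-bounded? n {P} P? = map′ fromFin toFin (any? λ k → any? λ l → P? (toℕ k , toℕ l))
  where
  fromFin : ∃ (λ (k : Fin (suc n)) → ∃ λ l → P (toℕ k , toℕ l)) → ∃ λ u → Bounded n u × P u
  fromFin (k , l , Pkl) = (toℕ k , toℕ l) , (toℕ≤pred[n] k , toℕ≤pred[n] l) , Pkl
  toFin : (∃ λ u → Bounded n u × P u) → ∃ (λ (k : Fin (suc n)) → ∃ λ l → P (toℕ k , toℕ l))
  toFin ((k , l) , (k≤n , l≤n) , Pkl) = fromℕ< (s≤s k≤n) , fromℕ< (s≤s l≤n) ,
    subst₂ (λ k l → P (k , l)) (sym (toℕ-fromℕ< (s≤s k≤n))) (sym (toℕ-fromℕ< (s≤s l≤n))) Pkl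

_∈?_ : ∀ u B → Dec (u ∈ B)
u ∈? B = B u Bool.≟ true

fromDec : {P : Pair → Set} → (∀ u → Dec (P u)) → Subset
fromDec P? u = does (P? u)

∈-fromDec⁺ : ∀ {P : Pair → Set} (P? : ∀ u → Dec (P u)) {u} → P u → u ∈ fromDec P?
∈-fromDec⁺ P? {u} Pu with P? u
... | yes _ = refl
... | no ¬Pu = ⊥-elim (¬Pu Pu)

∈-fromDec⁻ : ∀ {P : Pair → Set} (P? : ∀ u → Dec (P u)) {u} → u ∈ fromDec P? → P u
∈-fromDec⁻ P? {u} u∈ with P? u
... | yes Pu = Pu

InQ⇒Bounded : ∀ {n m u} → InQ n m u → Bounded n u
InQ⇒Bounded (_ , k≤m , m<l , l≤n) = ℕP.≤-trans k≤m (ℕP.≤-trans (ℕP.n≤1+n _) (ℕP.≤-trans m<l l≤n)) , l≤n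

InQ⇒ValidPair : ∀ {n m u} → InQ n m u → ValidPair n u
InQ⇒ValidPair (1≤k , k≤m , m<l , l≤n) = 1≤k , ℕP.≤-trans (s≤s k≤m) m<l , l≤n

twoWeight-i : ∀ i a a' → twoWeight i a a' i ≡ a
twoWeight-i i a a' with i ℕ.≟ i
... | yes _ = refl
... | no i≢i = ⊥-elim (i≢i refl)

twoWeight-1+i : ∀ i a a' → twoWeight i a a' (suc i) ≡ a'
twoWeight-1+i i a a' with suc i ℕ.≟ i | suc i ℕ.≟ suc i
... | yes 1+i≡i | _ = ⊥-elim (ℕP.1+n≢n 1+i≡i)
... | no _ | yes _ = refl
... | no _ | no 1+i≢1+i = ⊥-elim (1+i≢1+i refl)

combo≡ℕtoℚ : ∀ a A a' A' u → combo a A a' A' u ≡ ℕtoℚ (a * 𝟙 A u + a' * 𝟙 A' u)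
combo≡ℕtoℚ a A a' A' u = trans (cong₂ ℚ._+_ (scale a A) (scale a' A'))
  (sym (ℕtoℚ-homo-+ (a * 𝟙 A u) (a' * 𝟙 A' u)))
  where
  scale : ∀ c B → ℕtoℚ c ℚ.* χ B u ≡ ℕtoℚ (c * 𝟙 B u)
  scale c B with B u
  ... | true = trans (ℚP.*-identityʳ (ℕtoℚ c)) (cong ℕtoℚ (sym (ℕP.*-identityʳ c)))
  ... | false = trans (ℚP.*-zeroʳ (ℕtoℚ c)) (cong ℕtoℚ (sym (ℕP.*-zeroʳ c)))

foldr-+-ℕtoℚ : ∀ {x : Point} {X : Pair → ℕ} → (∀ u → x u ≡ ℕtoℚ (X u)) → ∀ L →
               foldr ℚ._+_ 0ℚ (map x L) ≡ ℕtoℚ (Σ⟨ X ⟩ L)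
foldr-+-ℕtoℚ x≗X [] = refl
foldr-+-ℕtoℚ {X = X} x≗X (u ∷ L) =
  trans (cong₂ ℚ._+_ (x≗X u) (foldr-+-ℕtoℚ x≗X L)) (sym (ℕtoℚ-homo-+ (X u) (Σ⟨ X ⟩ L)))

InP-ℕtoℚ : ∀ {n b} (X : Pair → ℕ) → (∀ (d : DyckPath n) → Σ⟨ X ⟩ (pairs d) ≤ M b d) →
           InP n b (ℕtoℚ ∘ X)
InP-ℕtoℚ {b = b} X ΣX≤M = (λ u _ → ℕtoℚ-mono-≤ {n = X u} z≤n) , λ d →
  subst (ℚ._≤ ℕtoℚ (M b d)) (sym (foldr-+-ℕtoℚ {X = X} (λ _ → refl) (pairs d))) (ℕtoℚ-mono-≤ (ΣX≤M d))

InP⇒Σ≤M : ∀ {n b} {x : Point} {X : Pair → ℕ} → (∀ u → x u ≡ ℕtoℚ (X u)) → InP n b x →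
          ∀ (d : DyckPath n) → Σ⟨ X ⟩ (pairs d) ≤ M b d
InP⇒Σ≤M {b = b} {X = X} x≗X (_ , x-paths) d =
  ℕtoℚ-cancel-≤ (subst (ℚ._≤ ℕtoℚ (M b d)) (foldr-+-ℕtoℚ {X = X} x≗X (pairs d)) (x-paths d))

module CrossingPerturbation
  (n i a a' : ℕ) (1≤a : 1 ≤ a) (1≤a' : 1 ≤ a') {A A' : Subset}
  (A⊆Q : A ⊆Q[ n , i ]) (A'⊆Q : A' ⊆Q[ n , suc i ])
  (A-antichain : Antichain A) (A'-antichain : Antichain A') where

  -- A partner of an element of A or A' lies in Q, hence in [0, n]², so the search is finite.
  A↑? : ∀ u → Dec (u ∈ A × ∃ λ v → Bounded n v × v ∈ A' × v ⪯ u)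
  A↑? u = (u ∈? A) ×-dec ∃-bounded? n (λ v → (v ∈? A') ×-dec (v ⪯? u))

  A'↓? : ∀ v → Dec (v ∈ A' × ∃ λ u → Bounded n u × u ∈ A × v ⪯ u)
  A'↓? v = (v ∈? A') ×-dec ∃-bounded? n (λ u → (u ∈? A) ×-dec (v ⪯? u))

  A↑ A'↓ : Subset
  A↑ = fromDec A↑?
  A'↓ = fromDec A'↓?

  A↑⁺ : ∀ {u v} → u ∈ A → v ∈ A' → v ⪯ u → u ∈ A↑
  A↑⁺ {v = v} u∈A v∈A' v⪯u = ∈-fromDec⁺ A↑? (u∈A , v , InQ⇒Bounded (A'⊆Q v v∈A') , v∈A' , v⪯u)

  A'↓⁺ : ∀ {u v} → u ∈ A → v ∈ A' → v ⪯ u → v ∈ A'↓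
  A'↓⁺ {u} u∈A v∈A' v⪯u = ∈-fromDec⁺ A'↓? (v∈A' , u , InQ⇒Bounded (A⊆Q u u∈A) , u∈A , v⪯u)

  A↑⁻ : ∀ {u} → u ∈ A↑ → u ∈ A × ∃ λ v → v ∈ A' × v ⪯ u
  A↑⁻ u∈A↑ with ∈-fromDec⁻ A↑? u∈A↑
  ... | u∈A , v , _ , v∈A' , v⪯u = u∈A , v , v∈A' , v⪯u

  A'↓⁻ : ∀ {v} → v ∈ A'↓ → v ∈ A' × ∃ λ u → u ∈ A × v ⪯ u
  A'↓⁻ v∈A'↓ with ∈-fromDec⁻ A'↓? v∈A'↓
  ... | v∈A' , u , _ , u∈A , v⪯u = v∈A' , u , u∈A , v⪯u

  A↑-straddles : ∀ {u} → u ∈ A↑ → Straddles i u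
  A↑-straddles {u} u∈A↑ with A↑⁻ u∈A↑
  ... | u∈A , v , v∈A' , (_ , lᵥ≤lᵤ) =
    proj₁ (proj₂ (A⊆Q u u∈A)) , ℕP.≤-trans (proj₁ (proj₂ (proj₂ (A'⊆Q v v∈A')))) lᵥ≤lᵤ

  A'↓-straddles : ∀ {v} → v ∈ A'↓ → Straddles i v
  A'↓-straddles {v} v∈A'↓ with A'↓⁻ v∈A'↓
  ... | v∈A' , u , u∈A , (kᵥ≤kᵤ , _) =
    ℕP.≤-trans kᵥ≤kᵤ (proj₁ (proj₂ (A⊆Q u u∈A))) , proj₁ (proj₂ (proj₂ (A'⊆Q v v∈A')))

  A↑-closed : ∀ {u v} → u ∈ A↑ → v ∈ A' → Comparable u v → v ∈ A'↓
  A↑-closed u∈A↑ v∈A' (inj₂ v⪯u) = A'↓⁺ (proj₁ (A↑⁻ u∈A↑)) v∈A' v⪯u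
  A↑-closed {v = v} u∈A↑ v∈A' (inj₁ u⪯v) with A↑⁻ u∈A↑
  ... | u∈A , w , w∈A' , w⪯u with A'-antichain w v w∈A' v∈A' (⪯-trans w⪯u u⪯v)
  ...   | refl = A'↓⁺ u∈A w∈A' w⪯u

  A'↓-closed : ∀ {v u} → v ∈ A'↓ → u ∈ A → Comparable v u → u ∈ A↑
  A'↓-closed v∈A'↓ u∈A (inj₁ v⪯u) = A↑⁺ u∈A (proj₁ (A'↓⁻ v∈A'↓)) v⪯u
  A'↓-closed {u = u} v∈A'↓ u∈A (inj₂ u⪯v) with A'↓⁻ v∈A'↓
  ... | v∈A' , w , w∈A , v⪯w with A-antichain u w u∈A w∈A (⪯-trans u⪯v v⪯w)
  ...   | refl = A↑⁺ u∈A v∈A' v⪯w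

  μ : ℕ → ℕ
  μ = twoWeight i a a'

  -- The truncated subtraction never truncates: A'↓ ⊆ A' and A↑ ⊆ A, where X ≥ 1.
  X Y Z : Pair → ℕ
  X u = a * 𝟙 A u + a' * 𝟙 A' u
  Y u = X u + 𝟙 A↑ u ∸ 𝟙 A'↓ u
  Z u = X u + 𝟙 A'↓ u ∸ 𝟙 A↑ u

  X-pos : ∀ {u} → u ∈ A ⊎ u ∈ A' → 1 ≤ X u
  X-pos (inj₁ u∈A) rewrite u∈A = ℕP.≤-trans (ℕP.≤-trans 1≤a (ℕP.m≤m*n a 1)) (ℕP.m≤m+n _ _)
  X-pos (inj₂ u∈A') rewrite u∈A' = ℕP.≤-trans (ℕP.≤-trans 1≤a' (ℕP.m≤m*n a' 1)) (ℕP.m≤n+m _ _)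

  Y+𝟙≡X+𝟙 : ∀ u → Y u + 𝟙 A'↓ u ≡ X u + 𝟙 A↑ u
  Y+𝟙≡X+𝟙 u = m∸𝟙+𝟙≡m (X u + 𝟙 A↑ u) A'↓ λ u∈A'↓ →
    ℕP.≤-trans (X-pos (inj₂ (proj₁ (A'↓⁻ u∈A'↓)))) (ℕP.m≤m+n _ _)

  Z+𝟙≡X+𝟙 : ∀ u → Z u + 𝟙 A↑ u ≡ X u + 𝟙 A'↓ u
  Z+𝟙≡X+𝟙 u = m∸𝟙+𝟙≡m (X u + 𝟙 A'↓ u) A↑ λ u∈A↑ →
    ℕP.≤-trans (X-pos (inj₁ (proj₁ (A↑⁻ u∈A↑)))) (ℕP.m≤m+n _ _)

  Y+Z≡X+X : ∀ u → Y u + Z u ≡ X u + X u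
  Y+Z≡X+X u = ℕP.+-cancelʳ-≡ (𝟙 A'↓ u + 𝟙 A↑ u) _ _ (begin
    (Y u + Z u) + (𝟙 A'↓ u + 𝟙 A↑ u) ≡⟨ interchange (Y u) (Z u) (𝟙 A'↓ u) (𝟙 A↑ u) ⟩
    (Y u + 𝟙 A'↓ u) + (Z u + 𝟙 A↑ u) ≡⟨ cong₂ _+_ (Y+𝟙≡X+𝟙 u) (Z+𝟙≡X+𝟙 u) ⟩
    (X u + 𝟙 A↑ u) + (X u + 𝟙 A'↓ u) ≡⟨ interchange (X u) (𝟙 A↑ u) (X u) (𝟙 A'↓ u) ⟩
    (X u + X u) + (𝟙 A↑ u + 𝟙 A'↓ u) ≡⟨ cong (X u + X u +_) (ℕP.+-comm (𝟙 A↑ u) (𝟙 A'↓ u)) ⟩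
    (X u + X u) + (𝟙 A'↓ u + 𝟙 A↑ u) ∎)
    where open ≡-Reasoning

  ΣX≡ : ∀ L → Σ⟨ X ⟩ L ≡ a * count A L + a' * count A' L
  ΣX≡ L = trans (Σ-+ _ _ L) (cong₂ _+_ (Σ-* a (𝟙 A) L) (Σ-* a' (𝟙 A') L))

  straddles⇒a+a'≤M : ∀ (d : DyckPath n) {u} → u ∈L pairs d → Straddles i u → a + a' ≤ M μ d
  straddles⇒a+a'≤M d u∈d u-straddles = subst₂ (λ α β → α + β ≤ M μ d)
    (twoWeight-i i a a') (twoWeight-1+i i a a') (straddles⇒≤M μ d u∈d u-straddles)

  ΣY≤M : ∀ (d : DyckPath n) → Σ⟨ X ⟩ (pairs d) ≤ M μ d → Σ⟨ Y ⟩ (pairs d) ≤ M μ d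
  ΣY≤M d ΣX≤M = ℕP.+-cancelʳ-≤ (count A'↓ L) _ _ (begin
    Σ⟨ Y ⟩ L + count A'↓ L                       ≡⟨ Σ-+-cong Y (𝟙 A'↓) X (𝟙 A↑) Y+𝟙≡X+𝟙 L ⟩
    Σ⟨ X ⟩ L + count A↑ L                        ≡⟨ cong (_+ count A↑ L) (ΣX≡ L) ⟩
    a * count A L + a' * count A' L + count A↑ L ≤⟨ chain-shift-bound (pairs-≺-chain d) A-antichain 1≤a'
        (proj₁ ∘ A↑⁻) A↑-closed (λ u∈d → straddles⇒a+a'≤M d u∈d ∘ A↑-straddles)
        (subst (_≤ M μ d) (ΣX≡ L) ΣX≤M) ⟩
    M μ d + count A'↓ L                          ∎)
    where
    L : List Pair
    L = pairs d
    open ℕP.≤-Reasoning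

  ΣZ≤M : ∀ (d : DyckPath n) → Σ⟨ X ⟩ (pairs d) ≤ M μ d → Σ⟨ Z ⟩ (pairs d) ≤ M μ d
  ΣZ≤M d ΣX≤M = ℕP.+-cancelʳ-≤ (count A↑ L) _ _ (begin
    Σ⟨ Z ⟩ L + count A↑ L                         ≡⟨ Σ-+-cong Z (𝟙 A↑) X (𝟙 A'↓) Z+𝟙≡X+𝟙 L ⟩
    Σ⟨ X ⟩ L + count A'↓ L                        ≡⟨ cong (_+ count A'↓ L) ΣX≡' ⟩
    a' * count A' L + a * count A L + count A'↓ L ≤⟨ chain-shift-bound (pairs-≺-chain d) A'-antichain 1≤a
        (proj₁ ∘ A'↓⁻) A'↓-closed
        (λ v∈d → subst (_≤ M μ d) (ℕP.+-comm a a') ∘ straddles⇒a+a'≤M d v∈d ∘ A'↓-straddles)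
        (subst (_≤ M μ d) ΣX≡' ΣX≤M) ⟩
    M μ d + count A↑ L                            ∎)
    where
    L : List Pair
    L = pairs d
    ΣX≡' : Σ⟨ X ⟩ L ≡ a' * count A' L + a * count A L
    ΣX≡' = trans (ΣX≡ L) (ℕP.+-comm (a * count A L) (a' * count A' L))
    open ℕP.≤-Reasoning

  x : Point
  x = combo a A a' A'

  x-midpoint : ∀ u → ValidPair n u → x u ≡ ½ ℚ.* (ℕtoℚ (Y u) ℚ.+ ℕtoℚ (Z u))
  x-midpoint u _ = begin
    x u                                 ≡⟨ combo≡ℕtoℚ a A a' A' u ⟩
    ℕtoℚ (X u)                          ≡⟨ ½*[r+r]≡r (ℕtoℚ (X u)) ⟨
    ½ ℚ.* (ℕtoℚ (X u) ℚ.+ ℕtoℚ (X u))   ≡⟨ cong (½ ℚ.*_) (ℕtoℚ-homo-+ (X u) (X u)) ⟨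
    ½ ℚ.* ℕtoℚ (X u + X u)              ≡⟨ cong (λ w → ½ ℚ.* ℕtoℚ w) (Y+Z≡X+X u) ⟨
    ½ ℚ.* ℕtoℚ (Y u + Z u)              ≡⟨ cong (½ ℚ.*_) (ℕtoℚ-homo-+ (Y u) (Z u)) ⟩
    ½ ℚ.* (ℕtoℚ (Y u) ℚ.+ ℕtoℚ (Z u))   ∎
    where open ≡-Reasoning

  vertex⇒Y≡Z : IsVertex n μ x → ∀ u → ValidPair n u → Y u ≡ Z u
  vertex⇒Y≡Z (x∈P , x-extreme) u u-valid = ℕtoℚ-injective
    (x-extreme (ℕtoℚ ∘ Y) (ℕtoℚ ∘ Z) (InP-ℕtoℚ {b = μ} Y λ d → ΣY≤M d (ΣX≤M d))
      (InP-ℕtoℚ {b = μ} Z λ d → ΣZ≤M d (ΣX≤M d)) x-midpoint u u-valid)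
    where
    ΣX≤M : ∀ (d : DyckPath n) → Σ⟨ X ⟩ (pairs d) ≤ M μ d
    ΣX≤M = InP⇒Σ≤M {b = μ} (combo≡ℕtoℚ a A a' A') x∈P

  vertex⇒A'↓⊆A↑ : IsVertex n μ x → ∀ {u} → u ∈ A'↓ → u ∈ A↑
  vertex⇒A'↓⊆A↑ vertex {u} u∈A'↓ = 𝟙-shift-cancel (X u) A↑ A'↓ u∈A'↓
    (vertex⇒Y≡Z vertex u (InQ⇒ValidPair (A'⊆Q u (proj₁ (A'↓⁻ u∈A'↓)))))

corollary2p4 : (n i a a' : ℕ) → 3 ≤ n → 1 ≤ i → i ≤ n ∸ 2 → 1 ≤ a → 1 ≤ a' →
    (A A' : Subset) → A ⊆Q[ n , i ] → A' ⊆Q[ n , suc i ] →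
    Antichain A → Antichain A' →
    IsVertex n (twoWeight i a a') (combo a A a' A') →
    ∀ p q → p ∈ A → q ∈ A' → (p ⪯ q ⊎ q ⪯ p) → p ⪯ q
corollary2p4 _ _ _ _ _ _ _ _ _ _ _ _ _ _ _ _ _ _ _ _ (inj₁ p⪯q) = p⪯q
corollary2p4 n i a a' _ _ _ 1≤a 1≤a' A A' A⊆Q A'⊆Q A-antichain A'-antichain vertex p q p∈A q∈A' (inj₂ q⪯p) =
  subst (p ⪯_) (sym (A-antichain q p q∈A p∈A q⪯p)) (⪯-refl p)
  where
  open CrossingPerturbation n i a a' 1≤a 1≤a' A⊆Q A'⊆Q A-antichain A'-antichain
  q∈A : q ∈ A
  q∈A = proj₁ (A↑⁻ (vertex⇒A'↓⊆A↑ vertex (A'↓⁺ p∈A q∈A' q⪯p)))
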